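{- Let $r\geqslant 2$ be an integer, $q$ a prime power, $K=\mathbb{F}_q(t)$, and for an indeterminate $z$ let $\Phi^{(z)}$ be the Drinfeld module with $\Phi^{(z)}_T(x)=tx+zx^q+x^{q^r}$. Let $\mathbf a=\mathbf a_1/\mathbf a_2\in K$ with $\mathbf a_1,\mathbf a_2$ nonzero coprime polynomials in $\mathbb{F}_q[t]$, and for each positive integer $n$ let $f_n(z)=\Phi^{(z)}_{T^n}(\mathbf a)\in K[z]$. Then $g_n(z):=\mathbf a_2^{q^{rn}}\cdot f_n(z)\in\mathbb{F}_q[t][z]$, and $\mathfrak{h}(g_n)\leqslant(2+\deg(\mathbf a))^{q^{rn}}$.
   Context: $\Phi^{(z)}_{T^n}$ is the $n$-fold composition of $\Phi^{(z)}_T$. The degree $\deg(\mathbf a)$ is $\max\{\deg\mathbf a_1,\deg\mathbf a_2\}$. For $g\in\mathbb{F}_q[t][z]$, the height $\mathfrak{h}(g)$ is the maximum of the degrees in $t$ of the coefficients of $g$. -}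

module Defs where

open import Level using (0ℓ)
open import Data.Nat using (ℕ; zero; suc; _<_; _^_)
open import Data.Nat.Primality using (Prime)
open import Data.Fin using (Fin)
open import Data.List using (List; []; _∷_; map)
open import Data.Product using (Σ; ∃; _×_; _,_; proj₁; proj₂)
open import Relation.Nullary using (¬_)
open import Relation.Binary.PropositionalEquality using (_≡_)
open import Algebra.Bundles using (CommutativeRing)

IsPrimePower : ℕ → Set
IsPrimePower q = ∃ λ p → ∃ λ k → Prime p × (q ≡ p ^ suc k)

record IsFieldCR (R : CommutativeRing 0ℓ 0ℓ) : Set where
  open CommutativeRing R
  field
    0≉1 : ¬ (0# ≈ 1#)
    inverse : ∀ x → ¬ (x ≈ 0#) → ∃ λ y → x * y ≈ 1#

record FiniteField (q : ℕ) : Set₁ where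
  field
    cring   : CommutativeRing 0ℓ 0ℓ
    isField : IsFieldCR cring
  open CommutativeRing cring public hiding (ring)
  field
    enum     : Fin q → Carrier
    enum-inj : ∀ i j → enum i ≈ enum j → i ≡ j
    enum-sur : ∀ x → ∃ λ i → enum i ≈ x

-- Generic polynomial arithmetic on coefficient lists
-- (a list c₀ ∷ c₁ ∷ … represents c₀ + c₁ X + c₂ X² + …)
module PolyOps {A : Set} (zero# one# : A) (_⊕_ _⊗_ : A → A → A) where

  Poly : Set
  Poly = List A

  coeff : Poly → ℕ → A
  coeff []       _       = zero#
  coeff (c ∷ p)  zero    = c
  coeff (c ∷ p)  (suc k) = coeff p k

  _+P_ : Poly → Poly → Poly
  []      +P q       = q
  (a ∷ p) +P []      = a ∷ p
  (a ∷ p) +P (b ∷ q) = (a ⊕ b) ∷ (p +P q)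

  scale : A → Poly → Poly
  scale a p = map (a ⊗_) p

  _*P_ : Poly → Poly → Poly
  []      *P q = []
  (a ∷ p) *P q = scale a q +P (zero# ∷ (p *P q))

  const : A → Poly
  const a = a ∷ []

  oneP : Poly
  oneP = const one#

  X : Poly
  X = zero# ∷ one# ∷ []

  _^P_ : Poly → ℕ → Poly
  p ^P zero  = oneP
  p ^P suc m = p *P (p ^P m)

module Over {q : ℕ} (F : FiniteField q) where
  open FiniteField F

  open PolyOps 0# 1# _+_ _*_ public
    renaming (Poly to Fq[t]; coeff to coefT; _+P_ to _+T_; _*P_ to _*T_;
              const to constT; oneP to oneT; X to tT; _^P_ to _^T_; scale to scaleT)

  zeroT : Fq[t]
  zeroT = []

  _≈T_ : Fq[t] → Fq[t] → Set
  p ≈T r = ∀ k → coefT p k ≈ coefT r k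

  IsDegree : Fq[t] → ℕ → Set
  IsDegree p d = ¬ (coefT p d ≈ 0#) × (∀ k → d < k → coefT p k ≈ 0#)

  DegreeLE : Fq[t] → ℕ → Set
  DegreeLE p B = ∀ k → B < k → coefT p k ≈ 0#

  _∣T_ : Fq[t] → Fq[t] → Set
  d ∣T p = ∃ λ e → (e *T d) ≈T p

  Coprime : Fq[t] → Fq[t] → Set
  Coprime a b = ∀ d → d ∣T a → d ∣T b → d ∣T oneT

  -- K = F_q(t) as fractions num / den (den ≠ 0 for all fractions that occur)
  K : Set
  K = Fq[t] × Fq[t]

  _+K_ : K → K → K
  (a , b) +K (c , d) = ((a *T d) +T (c *T b)) , (b *T d)

  _*K_ : K → K → K
  (a , b) *K (c , d) = (a *T c) , (b *T d)

  0K 1K : K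
  0K = zeroT , oneT
  1K = oneT , oneT

  _≈K_ : K → K → Set
  (a , b) ≈K (c , d) = (a *T d) ≈T (c *T b)

  ιK : Fq[t] → K
  ιK p = p , oneT

  open PolyOps 0K 1K _+K_ _*K_ public
    renaming (Poly to K[z]; coeff to coefZ; _+P_ to _+Z_; _*P_ to _*Z_;
              const to constZ; oneP to oneZ; X to zZ; _^P_ to _^Z_; scale to scaleZ)

  _≈Z_ : K[z] → K[z] → Set
  f ≈Z g = ∀ i → coefZ f i ≈K coefZ g i

  Fq[t][z] : Set
  Fq[t][z] = List Fq[t]

  ιZ : Fq[t][z] → K[z]
  ιZ = map ιK

  coefTZ : Fq[t][z] → ℕ → Fq[t]
  coefTZ []      _       = zeroT
  coefTZ (c ∷ g) zero    = c
  coefTZ (c ∷ g) (suc i) = coefTZ g i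

  HeightLE : Fq[t][z] → ℕ → Set
  HeightLE g B = ∀ i → DegreeLE (coefTZ g i) B

  ΦT : ℕ → K[z] → K[z]
  ΦT r x = ((constZ (ιK tT) *Z x) +Z (zZ *Z (x ^Z q))) +Z (x ^Z (q ^ r))

  ΦTn : ℕ → ℕ → K[z] → K[z]
  ΦTn r zero    x = x
  ΦTn r (suc n) x = ΦT r (ΦTn r n x)

  fn : ℕ → Fq[t] → Fq[t] → ℕ → K[z]
  fn r a₁ a₂ n = ΦTn r n (constZ (a₁ , a₂))

module Submission where

-- If x = P / Y^N then Φ_T(x) = (Y^(N(q^r−1)) t P + Y^(N(q^r−q)) z P^q + P^(q^r)) / Y^(N q^r), so writing
-- f_n = g_n / a₂^N with N = q^(rn), the numerators g_n obey a recursion inside F_q[t][z]. With d = deg a,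
-- if every coefficient of P has t-degree ≤ N(d+1), then the three summands have height ≤ N q^r (d+1);
-- hence 𝔥(g_n) ≤ q^(rn)(d+1) ≤ (2+d)^(q^(rn)) by Bernoulli's inequality.

open import Level using (0ℓ)
open import Algebra.Bundles using (CommutativeSemiring; CommutativeRing)
open import Algebra.Structures.Biased using (isCommutativeSemiringˡ)
open import Data.List using ([]; _∷_)
open import Data.Nat using (ℕ; zero; suc; _<_; _≤_; z≤n; s≤s)
import Data.Nat as ℕ
import Data.Nat.Properties as ℕₚ
open import Data.Nat.Primality using (prime⇒nonTrivial)
open import Data.Product using (∃; _×_; _,_; proj₁; proj₂)
open import Relation.Binary.PropositionalEquality as ≡ using (_≡_)
open import Relation.Binary.Structures using (IsEquivalence)
open import Relation.Nullary using (¬_)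
open import Defs

module Polynomial (S : CommutativeSemiring 0ℓ 0ℓ) where

  open CommutativeSemiring S hiding (zero)
  open import Relation.Binary.Reasoning.Setoid setoid
  open import Algebra.Properties.CommutativeSemigroup +-commutativeSemigroup
    using (interchange; x∙yz≈y∙xz)
  open PolyOps 0# 1# _+_ _*_ public

  infix 4 _≈P_
  record _≈P_ (p p′ : Poly) : Set where
    constructor coeffwise
    field coeff-≈ : ∀ k → coeff p k ≈ coeff p′ k
  open _≈P_ public

  ≈P-refl : ∀ {p} → p ≈P p
  ≈P-refl = coeffwise λ _ → refl

  ≈P-sym : ∀ {p p′} → p ≈P p′ → p′ ≈P p
  ≈P-sym e = coeffwise λ k → sym (coeff-≈ e k)

  ≈P-trans : ∀ {p p′ p″} → p ≈P p′ → p′ ≈P p″ → p ≈P p″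
  ≈P-trans e f = coeffwise λ k → trans (coeff-≈ e k) (coeff-≈ f k)

  ∷-cong : ∀ {a b p p′} → a ≈ b → p ≈P p′ → a ∷ p ≈P b ∷ p′
  ∷-cong a≈b e = coeffwise λ { zero → a≈b ; (suc k) → coeff-≈ e k }

  ∷-injectiveʳ : ∀ {a b p p′} → a ∷ p ≈P b ∷ p′ → p ≈P p′
  ∷-injectiveʳ e = coeffwise λ k → coeff-≈ e (suc k)

  ∷≈[]⇒tail≈[] : ∀ {a p} → a ∷ p ≈P [] → p ≈P []
  ∷≈[]⇒tail≈[] e = coeffwise λ k → coeff-≈ e (suc k)

  0∷[]≈[] : 0# ∷ [] ≈P []
  0∷[]≈[] = coeffwise λ { zero → refl ; (suc k) → refl }

  tail : Poly → Poly
  tail []      = []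
  tail (_ ∷ p) = p

  ≈P-coeff0∷tail : ∀ p → p ≈P coeff p 0 ∷ tail p
  ≈P-coeff0∷tail []      = ≈P-sym 0∷[]≈[]
  ≈P-coeff0∷tail (a ∷ p) = ≈P-refl

  coeff-+P : ∀ p p′ k → coeff (p +P p′) k ≈ coeff p k + coeff p′ k
  coeff-+P []      p′      k       = sym (+-identityˡ _)
  coeff-+P (a ∷ p) []      k       = sym (+-identityʳ _)
  coeff-+P (a ∷ p) (b ∷ p′) zero    = refl
  coeff-+P (a ∷ p) (b ∷ p′) (suc k) = coeff-+P p p′ k

  coeff-scale : ∀ a p k → coeff (scale a p) k ≈ a * coeff p k
  coeff-scale a []      k       = sym (zeroʳ a)
  coeff-scale a (b ∷ p) zero    = refl
  coeff-scale a (b ∷ p) (suc k) = coeff-scale a p k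

  +P-coeffwise : ∀ p p′ r r′ → (∀ k → coeff p k + coeff p′ k ≈ coeff r k + coeff r′ k) →
                 p +P p′ ≈P r +P r′
  +P-coeffwise p p′ r r′ e = coeffwise λ k →
    trans (coeff-+P p p′ k) (trans (e k) (sym (coeff-+P r r′ k)))

  +P-cong : ∀ {p p′ r r′} → p ≈P p′ → r ≈P r′ → p +P r ≈P p′ +P r′
  +P-cong {p} {p′} {r} {r′} e f =
    +P-coeffwise p r p′ r′ λ k → +-cong (coeff-≈ e k) (coeff-≈ f k)

  +P-comm : ∀ p r → p +P r ≈P r +P p
  +P-comm p r = +P-coeffwise p r r p λ k → +-comm _ _

  +P-assoc : ∀ p r s → (p +P r) +P s ≈P p +P (r +P s)
  +P-assoc p r s = +P-coeffwise (p +P r) s p (r +P s) λ k → begin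
    coeff (p +P r) k + coeff s k         ≈⟨ +-congʳ (coeff-+P p r k) ⟩
    (coeff p k + coeff r k) + coeff s k  ≈⟨ +-assoc _ _ _ ⟩
    coeff p k + (coeff r k + coeff s k)  ≈⟨ +-congˡ (coeff-+P r s k) ⟨
    coeff p k + coeff (r +P s) k         ∎

  +P-identityʳ : ∀ p → p +P [] ≈P p
  +P-identityʳ []      = ≈P-refl
  +P-identityʳ (a ∷ p) = ≈P-refl

  +P-interchange : ∀ p r s u → (p +P r) +P (s +P u) ≈P (p +P s) +P (r +P u)
  +P-interchange p r s u = +P-coeffwise (p +P r) (s +P u) (p +P s) (r +P u) λ k → begin
    coeff (p +P r) k + coeff (s +P u) k
      ≈⟨ +-cong (coeff-+P p r k) (coeff-+P s u k) ⟩
    (coeff p k + coeff r k) + (coeff s k + coeff u k)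
      ≈⟨ interchange _ _ _ _ ⟩
    (coeff p k + coeff s k) + (coeff r k + coeff u k)
      ≈⟨ +-cong (coeff-+P p s k) (coeff-+P r u k) ⟨
    coeff (p +P s) k + coeff (r +P u) k ∎

  +P-leftComm : ∀ p r s → p +P (r +P s) ≈P r +P (p +P s)
  +P-leftComm p r s = +P-coeffwise p (r +P s) r (p +P s) λ k → begin
    coeff p k + coeff (r +P s) k         ≈⟨ +-congˡ (coeff-+P r s k) ⟩
    coeff p k + (coeff r k + coeff s k)  ≈⟨ x∙yz≈y∙xz _ _ _ ⟩
    coeff r k + (coeff p k + coeff s k)  ≈⟨ +-congˡ (coeff-+P p s k) ⟨
    coeff r k + coeff (p +P s) k         ∎

  0∷-+P : ∀ p r → 0# ∷ (p +P r) ≈P (0# ∷ p) +P (0# ∷ r)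
  0∷-+P p r = ∷-cong (sym (+-identityˡ 0#)) ≈P-refl

  scale-cong : ∀ {a b p p′} → a ≈ b → p ≈P p′ → scale a p ≈P scale b p′
  scale-cong {a} {b} {p} {p′} a≈b e = coeffwise λ k →
    trans (coeff-scale a p k) (trans (*-cong a≈b (coeff-≈ e k)) (sym (coeff-scale b p′ k)))

  scale-zeroˡ : ∀ p → scale 0# p ≈P []
  scale-zeroˡ p = coeffwise λ k → trans (coeff-scale 0# p k) (zeroˡ _)

  scale-identityˡ : ∀ p → scale 1# p ≈P p
  scale-identityˡ p = coeffwise λ k → trans (coeff-scale 1# p k) (*-identityˡ _)

  scale-distribˡ : ∀ a p r → scale a (p +P r) ≈P scale a p +P scale a r
  scale-distribˡ a p r = coeffwise λ k → begin
    coeff (scale a (p +P r)) k                ≈⟨ coeff-scale a (p +P r) k ⟩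
    a * coeff (p +P r) k                      ≈⟨ *-congˡ (coeff-+P p r k) ⟩
    a * (coeff p k + coeff r k)               ≈⟨ distribˡ _ _ _ ⟩
    a * coeff p k + a * coeff r k             ≈⟨ +-cong (coeff-scale a p k) (coeff-scale a r k) ⟨
    coeff (scale a p) k + coeff (scale a r) k ≈⟨ coeff-+P (scale a p) (scale a r) k ⟨
    coeff (scale a p +P scale a r) k          ∎

  scale-distribʳ : ∀ a b p → scale (a + b) p ≈P scale a p +P scale b p
  scale-distribʳ a b p = coeffwise λ k → begin
    coeff (scale (a + b) p) k                 ≈⟨ coeff-scale (a + b) p k ⟩
    (a + b) * coeff p k                       ≈⟨ distribʳ _ _ _ ⟩
    a * coeff p k + b * coeff p k             ≈⟨ +-cong (coeff-scale a p k) (coeff-scale b p k) ⟨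
    coeff (scale a p) k + coeff (scale b p) k ≈⟨ coeff-+P (scale a p) (scale b p) k ⟨
    coeff (scale a p +P scale b p) k          ∎

  scale-assoc : ∀ a b p → scale a (scale b p) ≈P scale (a * b) p
  scale-assoc a b p = coeffwise λ k → begin
    coeff (scale a (scale b p)) k ≈⟨ coeff-scale a (scale b p) k ⟩
    a * coeff (scale b p) k       ≈⟨ *-congˡ (coeff-scale b p k) ⟩
    a * (b * coeff p k)           ≈⟨ *-assoc _ _ _ ⟨
    (a * b) * coeff p k           ≈⟨ coeff-scale (a * b) p k ⟨
    coeff (scale (a * b) p) k     ∎

  0∷-scale : ∀ a p → scale a (0# ∷ p) ≈P 0# ∷ scale a p
  0∷-scale a p = ∷-cong (zeroʳ a) ≈P-refl

  *P-zeroˡ : ∀ {p} r → p ≈P [] → p *P r ≈P []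
  *P-zeroˡ {[]}    r e = ≈P-refl
  *P-zeroˡ {a ∷ p} r e =
    ≈P-trans (+P-cong (≈P-trans (scale-cong (coeff-≈ e zero) ≈P-refl) (scale-zeroˡ r))
                      (∷-cong refl (*P-zeroˡ r (∷≈[]⇒tail≈[] e))))
             0∷[]≈[]

  *P-congˡ : ∀ {p p′} r → p ≈P p′ → p *P r ≈P p′ *P r
  *P-congˡ {[]}    {p′}     r e = ≈P-sym (*P-zeroˡ r (≈P-sym e))
  *P-congˡ {a ∷ p} {[]}     r e = *P-zeroˡ r e
  *P-congˡ {a ∷ p} {b ∷ p′} r e =
    +P-cong (scale-cong (coeff-≈ e zero) ≈P-refl)
            (∷-cong refl (*P-congˡ r (∷-injectiveʳ e)))

  *P-congʳ : ∀ p {r r′} → r ≈P r′ → p *P r ≈P p *P r′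
  *P-congʳ []      e = ≈P-refl
  *P-congʳ (a ∷ p) e = +P-cong (scale-cong refl e) (∷-cong refl (*P-congʳ p e))

  *P-cong : ∀ {p p′ r r′} → p ≈P p′ → r ≈P r′ → p *P r ≈P p′ *P r′
  *P-cong {p′ = p′} {r} e f = ≈P-trans (*P-congˡ r e) (*P-congʳ p′ f)

  *P-distribʳ : ∀ r p p′ → (p +P p′) *P r ≈P (p *P r) +P (p′ *P r)
  *P-distribʳ r []      p′       = ≈P-refl
  *P-distribʳ r (a ∷ p) []       = ≈P-sym (+P-identityʳ _)
  *P-distribʳ r (a ∷ p) (b ∷ p′) =
    ≈P-trans (+P-cong (scale-distribʳ a b r)
                      (≈P-trans (∷-cong refl (*P-distribʳ r p p′)) (0∷-+P (p *P r) (p′ *P r))))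
             (+P-interchange (scale a r) (scale b r) (0# ∷ (p *P r)) (0# ∷ (p′ *P r)))

  *P-∷ʳ : ∀ p a r → p *P (a ∷ r) ≈P scale a p +P (0# ∷ (p *P r))
  *P-∷ʳ []      a r = ≈P-sym 0∷[]≈[]
  *P-∷ʳ (b ∷ p) a r = ∷-cong (+-congʳ (*-comm b a))
    (≈P-trans (+P-cong (≈P-refl {scale b r}) (*P-∷ʳ p a r))
              (+P-leftComm (scale b r) (scale a p) (0# ∷ (p *P r))))

  *P-zeroʳ : ∀ p → p *P [] ≈P []
  *P-zeroʳ []      = ≈P-refl
  *P-zeroʳ (a ∷ p) = ≈P-trans (∷-cong refl (*P-zeroʳ p)) 0∷[]≈[]

  *P-comm : ∀ p r → p *P r ≈P r *P p
  *P-comm []      r = ≈P-sym (*P-zeroʳ r)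
  *P-comm (a ∷ p) r =
    ≈P-sym (≈P-trans (*P-∷ʳ r a p) (+P-cong ≈P-refl (∷-cong refl (*P-comm r p))))

  scale-*P : ∀ a p r → scale a p *P r ≈P scale a (p *P r)
  scale-*P a []      r = ≈P-refl
  scale-*P a (b ∷ p) r = ≈P-sym
    (≈P-trans (scale-distribˡ a (scale b r) (0# ∷ (p *P r)))
              (+P-cong (scale-assoc a b r)
                       (≈P-trans (0∷-scale a (p *P r)) (∷-cong refl (≈P-sym (scale-*P a p r))))))

  0∷-*P : ∀ p r → (0# ∷ p) *P r ≈P 0# ∷ (p *P r)
  0∷-*P p r = +P-cong (scale-zeroˡ r) ≈P-refl

  *P-assoc : ∀ p r s → (p *P r) *P s ≈P p *P (r *P s)
  *P-assoc []      r s = ≈P-refl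
  *P-assoc (a ∷ p) r s =
    ≈P-trans (*P-distribʳ s (scale a r) (0# ∷ (p *P r)))
             (+P-cong (scale-*P a r s)
                      (≈P-trans (0∷-*P (p *P r) s) (∷-cong refl (*P-assoc p r s))))

  *P-identityˡ : ∀ p → oneP *P p ≈P p
  *P-identityˡ p =
    ≈P-trans (+P-cong (scale-identityˡ p) 0∷[]≈[]) (+P-identityʳ p)

  ^P-homo-*P : ∀ p m n → p ^P (m ℕ.+ n) ≈P (p ^P m) *P (p ^P n)
  ^P-homo-*P p zero    n = ≈P-sym (*P-identityˡ (p ^P n))
  ^P-homo-*P p (suc m) n =
    ≈P-trans (*P-congʳ p (^P-homo-*P p m n)) (≈P-sym (*P-assoc p (p ^P m) (p ^P n)))

  ^P-assocʳ : ∀ p m n → (p ^P m) ^P n ≈P p ^P (m ℕ.* n)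
  ^P-assocʳ p m zero    rewrite ℕₚ.*-zeroʳ m = ≈P-refl
  ^P-assocʳ p m (suc n) rewrite ℕₚ.*-suc m n =
    ≈P-trans (*P-congʳ (p ^P m) (^P-assocʳ p m n)) (≈P-sym (^P-homo-*P p m (m ℕ.* n)))

  commutativeSemiring : CommutativeSemiring 0ℓ 0ℓ
  commutativeSemiring = record
    { isCommutativeSemiring = isCommutativeSemiringˡ record
      { +-isCommutativeMonoid = record
        { isMonoid = record
          { isSemigroup = record
            { isMagma = record { isEquivalence = ≈P-isEquivalence ; ∙-cong = +P-cong }
            ; assoc = +P-assoc }
          ; identity = (λ _ → ≈P-refl) , +P-identityʳ }
        ; comm = +P-comm }
      ; *-isCommutativeMonoid = record
        { isMonoid = record
          { isSemigroup = record
            { isMagma = record { isEquivalence = ≈P-isEquivalence ; ∙-cong = *P-cong }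
            ; assoc = *P-assoc }
          ; identity = *P-identityˡ , λ p → ≈P-trans (*P-comm p oneP) (*P-identityˡ p) }
        ; comm = *P-comm }
      ; distribʳ = *P-distribʳ
      ; zeroˡ = λ _ → ≈P-refl }
    }
    where
    ≈P-isEquivalence : IsEquivalence _≈P_
    ≈P-isEquivalence = record { refl = ≈P-refl ; sym = ≈P-sym ; trans = ≈P-trans }

  record Degree≤ (p : Poly) (m : ℕ) : Set where
    constructor degree≤
    field vanishes-above : ∀ k → m < k → coeff p k ≈ 0#
  open Degree≤ public

  degree-cong : ∀ {p p′ m} → p ≈P p′ → Degree≤ p m → Degree≤ p′ m
  degree-cong e (degree≤ d) = degree≤ λ k m<k → trans (sym (coeff-≈ e k)) (d k m<k)

  degree-mono : ∀ {p m m′} → m ≤ m′ → Degree≤ p m → Degree≤ p m′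
  degree-mono m≤m′ (degree≤ d) = degree≤ λ k m′<k → d k (ℕₚ.≤-<-trans m≤m′ m′<k)

  degree-[] : ∀ {m} → Degree≤ [] m
  degree-[] = degree≤ λ _ _ → refl

  degree-oneP : Degree≤ oneP 0
  degree-oneP = degree≤ λ { (suc k) _ → refl }

  degree-X : Degree≤ X 1
  degree-X = degree≤ λ { (suc zero) (s≤s ()) ; (suc (suc k)) _ → refl }

  degree-0∷ : ∀ {p m} → Degree≤ p m → Degree≤ (0# ∷ p) (suc m)
  degree-0∷ (degree≤ d) = degree≤ λ { (suc k) (s≤s m<k) → d k m<k }

  degree-tail : ∀ {a p m} → Degree≤ (a ∷ p) (suc m) → Degree≤ p m
  degree-tail (degree≤ d) = degree≤ λ k m<k → d (suc k) (s≤s m<k)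

  degree-0⇒tail≈[] : ∀ {a p} → Degree≤ (a ∷ p) 0 → p ≈P []
  degree-0⇒tail≈[] (degree≤ d) = coeffwise λ k → d (suc k) (s≤s z≤n)

  degree-+P : ∀ {p r m} → Degree≤ p m → Degree≤ r m → Degree≤ (p +P r) m
  degree-+P {p} {r} (degree≤ dp) (degree≤ dr) = degree≤ λ k m<k →
    trans (coeff-+P p r k) (trans (+-cong (dp k m<k) (dr k m<k)) (+-identityˡ 0#))

  degree-scale : ∀ {a p m} → Degree≤ p m → Degree≤ (scale a p) m
  degree-scale {a} {p} (degree≤ d) = degree≤ λ k m<k →
    trans (coeff-scale a p k) (trans (*-congˡ (d k m<k)) (zeroʳ a))

  degree-*P : ∀ p {r m m′} → Degree≤ p m → Degree≤ r m′ → Degree≤ (p *P r) (m ℕ.+ m′)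
  degree-*P []      _ _ = degree-[]
  degree-*P (a ∷ p) {r} {zero} dp dr =
    degree-+P (degree-scale dr) (degree-cong (≈P-sym 0∷p*r≈[]) degree-[])
    where
    0∷p*r≈[] : 0# ∷ (p *P r) ≈P []
    0∷p*r≈[] = ≈P-trans (∷-cong refl (*P-zeroˡ r (degree-0⇒tail≈[] dp))) 0∷[]≈[]
  degree-*P (a ∷ p) {r} {suc m} {m′} dp dr =
    degree-+P (degree-mono (ℕₚ.m≤n+m m′ (suc m)) (degree-scale dr))
              (degree-0∷ (degree-*P p (degree-tail dp) dr))

  degree-^P : ∀ {p m} → Degree≤ p m → ∀ k → Degree≤ (p ^P k) (k ℕ.* m)
  degree-^P dp zero        = degree-oneP
  degree-^P {p} dp (suc k) = degree-*P p dp (degree-^P dp k)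

module Height (S : CommutativeSemiring 0ℓ 0ℓ) where

  module T = Polynomial S
  module Z = Polynomial T.commutativeSemiring
  open T using (Degree≤; degree-cong; degree-mono; degree-[]; degree-*P)

  record Height≤ (G : Z.Poly) (B : ℕ) : Set where
    constructor height≤
    field coeff-degree≤ : ∀ i → Degree≤ (Z.coeff G i) B
  open Height≤ public

  height-[] : ∀ {B} → Height≤ [] B
  height-[] = height≤ λ _ → degree-[]

  height-mono : ∀ {G B B′} → B ≤ B′ → Height≤ G B → Height≤ G B′
  height-mono B≤B′ h = height≤ λ i → degree-mono B≤B′ (coeff-degree≤ h i)

  height-∷ : ∀ {c G B} → Degree≤ c B → Height≤ G B → Height≤ (c ∷ G) B
  height-∷ dc h = height≤ λ { zero → dc ; (suc i) → coeff-degree≤ h i }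

  height-tail : ∀ {c G B} → Height≤ (c ∷ G) B → Height≤ G B
  height-tail h = height≤ λ i → coeff-degree≤ h (suc i)

  height-+P : ∀ {G H B} → Height≤ G B → Height≤ H B → Height≤ (G Z.+P H) B
  height-+P {G} {H} hG hH = height≤ λ i →
    degree-cong (T.≈P-sym (Z.coeff-+P G H i)) (T.degree-+P (coeff-degree≤ hG i) (coeff-degree≤ hH i))

  height-scale : ∀ {c e G B} → Degree≤ c e → Height≤ G B → Height≤ (Z.scale c G) (e ℕ.+ B)
  height-scale {c} {G = G} dc h = height≤ λ i →
    degree-cong (T.≈P-sym (Z.coeff-scale c G i)) (degree-*P c dc (coeff-degree≤ h i))

  height-*P : ∀ G {H B B′} → Height≤ G B → Height≤ H B′ → Height≤ (G Z.*P H) (B ℕ.+ B′)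
  height-*P []      hG hH = height-[]
  height-*P (c ∷ G) hG hH =
    height-+P (height-scale (coeff-degree≤ hG zero) hH)
              (height-∷ degree-[] (height-*P G (height-tail hG) hH))

  height-const : ∀ {c B} → Degree≤ c B → Height≤ (Z.const c) B
  height-const dc = height-∷ dc height-[]

  height-X : Height≤ Z.X 0
  height-X = height-∷ degree-[] (height-const T.degree-oneP)

  height-^P : ∀ {G B} → Height≤ G B → ∀ k → Height≤ (G Z.^P k) (k ℕ.* B)
  height-^P hG zero        = height-const T.degree-oneP
  height-^P {G} hG (suc k) = height-*P G hG (height-^P hG k)

module HeightArithmetic where

  open import Data.Nat
  open import Data.Nat.Properties
  open import Data.Nat.Tactic.RingSolver using (solve-∀)
  open import Relation.Binary.PropositionalEquality using (_≡_; refl)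
  open ≤-Reasoning

  -- For Height≤ P (N(d+1)) and Degree≤ Y d: the heights of Y^(Nu)·t·P, Y^(Nqv)·z·P^q and P^Q,
  -- where M = N + Nu = Nq + Nqv = NQ is the new exponent of the denominator.
  linear-term-bound : ∀ N u d {M} → N + N * u ≡ M → 1 ≤ N * u →
                      N * u * d + (1 + N * suc d) ≤ M * suc d
  linear-term-bound N u d refl 1≤Nu = begin
    N * u * d + (1 + N * suc d)   ≡⟨ swap N u d 1 ⟩
    N * u * d + N * suc d + 1     ≤⟨ +-monoʳ-≤ (N * u * d + N * suc d) 1≤Nu ⟩
    N * u * d + N * suc d + N * u ≡⟨ collect N u d ⟩
    (N + N * u) * suc d           ∎
    where
    swap : ∀ N u d e → N * u * d + (e + N * suc d) ≡ N * u * d + N * suc d + e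
    swap = solve-∀
    collect : ∀ N u d → N * u * d + N * suc d + N * u ≡ (N + N * u) * suc d
    collect = solve-∀

  middle-term-bound : ∀ N q v d {M} → N * q + N * q * v ≡ M →
                      N * q * v * d + (0 + q * (N * suc d)) ≤ M * suc d
  middle-term-bound N q v d refl = m+n≤o⇒m≤o _ (≤-reflexive (collect N q v d))
    where
    collect : ∀ N q v d → N * q * v * d + (0 + q * (N * suc d)) + N * q * v ≡ (N * q + N * q * v) * suc d
    collect = solve-∀

  top-term-bound : ∀ N Q d → Q * (N * suc d) ≤ N * Q * suc d
  top-term-bound N Q d = ≤-reflexive (rearrange N Q d)
    where
    rearrange : ∀ N Q d → Q * (N * suc d) ≡ N * Q * suc d
    rearrange = solve-∀

  1+n*m≤[1+m]^n : ∀ m n → 1 + n * m ≤ suc m ^ n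
  1+n*m≤[1+m]^n m zero    = ≤-refl
  1+n*m≤[1+m]^n m (suc n) = begin
    1 + (m + n * m)           ≡⟨ swap m (n * m) ⟩
    (1 + n * m) + m           ≤⟨ +-mono-≤ (1+n*m≤[1+m]^n m n) (m≤m*n m (suc m ^ n) {{m^n≢0 (suc m) n}}) ⟩
    suc m ^ n + m * suc m ^ n ∎
    where
    swap : ∀ a b → 1 + (a + b) ≡ (1 + b) + a
    swap = solve-∀

module Fractions {q : ℕ} (F : FiniteField q) where

  open Over F
  open Height (CommutativeRing.commutativeSemiring (FiniteField.cring F)) public
  open T using (_≈P_; ≈P-refl; ≈P-sym; ≈P-trans)
  open CommutativeSemiring T.commutativeSemiring
    using (setoid; +-cong; *-cong; *-congˡ; *-congʳ; *-identityʳ)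
  open import Relation.Binary.Reasoning.Setoid setoid
  open import Algebra.Solver.Ring.NaturalCoefficients.Default T.commutativeSemiring

  infix 4 _≃_/_ _≃ᶻ_/_

  -- k = p / D in K, cross-multiplied: this needs no nonzero denominators, whereas ≈K is transitive only
  -- when they are nonzero, which is why nothing below is computed up to ≈K.
  record _≃_/_ (k : K) (p D : Fq[t]) : Set where
    constructor cross
    field cross-≈ : proj₁ k *T D ≈P p *T proj₂ k
  open _≃_/_ public

  ≃-cong-num : ∀ {k p p′ D} → k ≃ p / D → p ≈P p′ → k ≃ p′ / D
  ≃-cong-num {_ , b} (cross e) p≈p′ = cross (≈P-trans e (*-congʳ p≈p′))

  ≃-cong-den : ∀ {k p D D′} → D ≈P D′ → k ≃ p / D → k ≃ p / D′
  ≃-cong-den {a , _} D≈D′ (cross e) = cross (≈P-trans (*-congˡ {a} (≈P-sym D≈D′)) e)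

  0K-≃⇒≈[] : ∀ {p D} → 0K ≃ p / D → p ≈P []
  0K-≃⇒≈[] {p} (cross e) = ≈P-trans (≈P-sym (*-identityʳ p)) (≈P-sym e)

  ≈[]⇒0K-≃ : ∀ {p D} → p ≈P [] → 0K ≃ p / D
  ≈[]⇒0K-≃ {p} p≈[] = cross (≈P-sym (≈P-trans (*-identityʳ p) p≈[]))

  ≃-+K : ∀ {a b c d p p′ D} → (a , b) ≃ p / D → (c , d) ≃ p′ / D →
         (a , b) +K (c , d) ≃ p +T p′ / D
  ≃-+K {a} {b} {c} {d} {p} {p′} {D} (cross e) (cross e′) = cross (begin
    ((a *T d) +T (c *T b)) *T D
      ≈⟨ solve 5 (λ a b c d D → (a :* d :+ c :* b) :* D := (a :* D) :* d :+ (c :* D) :* b) ≈P-refl a b c d D ⟩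
    ((a *T D) *T d) +T ((c *T D) *T b)
      ≈⟨ +-cong (*-congʳ e) (*-congʳ e′) ⟩
    ((p *T b) *T d) +T ((p′ *T d) *T b)
      ≈⟨ solve 4 (λ p p′ b d → (p :* b) :* d :+ (p′ :* d) :* b := (p :+ p′) :* (b :* d)) ≈P-refl p p′ b d ⟩
    (p +T p′) *T (b *T d) ∎)

  ≃-*K : ∀ {a b c d p p′ D D′} → (a , b) ≃ p / D → (c , d) ≃ p′ / D′ →
         (a , b) *K (c , d) ≃ p *T p′ / D *T D′
  ≃-*K {a} {b} {c} {d} {p} {p′} {D} {D′} (cross e) (cross e′) = cross (begin
    (a *T c) *T (D *T D′)
      ≈⟨ solve 4 (λ a c D D′ → (a :* c) :* (D :* D′) := (a :* D) :* (c :* D′)) ≈P-refl a c D D′ ⟩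
    (a *T D) *T (c *T D′)
      ≈⟨ *-cong e e′ ⟩
    (p *T b) *T (p′ *T d)
      ≈⟨ solve 4 (λ p b p′ d → (p :* b) :* (p′ :* d) := (p :* p′) :* (b :* d)) ≈P-refl p b p′ d ⟩
    (p *T p′) *T (b *T d) ∎)

  ≃-expand : ∀ {k p D} E → k ≃ p / D → k ≃ E *T p / D *T E
  ≃-expand {a , b} {p} {D} E (cross e) = cross (begin
    a *T (D *T E)   ≈⟨ solve 3 (λ a D E → a :* (D :* E) := (a :* D) :* E) ≈P-refl a D E ⟩
    (a *T D) *T E   ≈⟨ *-congʳ e ⟩
    (p *T b) *T E   ≈⟨ solve 3 (λ p b E → (p :* b) :* E := (E :* p) :* b) ≈P-refl p b E ⟩
    (E *T p) *T b   ∎)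

  ≃-clear : ∀ {k p D} → k ≃ p / D → ιK D *K k ≃ p / oneT
  ≃-clear {a , b} {p} {D} (cross e) = cross (begin
    (D *T a) *T oneT ≈⟨ solve 2 (λ D a → (D :* a) :* con 1 := a :* D) ≈P-refl D a ⟩
    a *T D           ≈⟨ e ⟩
    p *T b           ≈⟨ solve 2 (λ p b → p :* b := p :* (con 1 :* b)) ≈P-refl p b ⟩
    p *T (oneT *T b) ∎)

  record _≃ᶻ_/_ (x : K[z]) (P : Fq[t][z]) (D : Fq[t]) : Set where
    constructor coeffwise
    field coeff-≃ : ∀ i → coefZ x i ≃ Z.coeff P i / D
  open _≃ᶻ_/_ public

  ≃ᶻ-cong-num : ∀ {x P P′ D} → x ≃ᶻ P / D → P Z.≈P P′ → x ≃ᶻ P′ / D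
  ≃ᶻ-cong-num e P≈P′ = coeffwise λ i → ≃-cong-num (coeff-≃ e i) (Z.coeff-≈ P≈P′ i)

  ≃ᶻ-cong-den : ∀ {x P D D′} → D ≈P D′ → x ≃ᶻ P / D → x ≃ᶻ P / D′
  ≃ᶻ-cong-den D≈D′ e = coeffwise λ i → ≃-cong-den D≈D′ (coeff-≃ e i)

  []-≃ᶻ⇒≈[] : ∀ {P D} → [] ≃ᶻ P / D → P Z.≈P []
  []-≃ᶻ⇒≈[] e = Z.coeffwise λ i → 0K-≃⇒≈[] (coeff-≃ e i)

  ≃ᶻ-tail : ∀ {a x P D} → a ∷ x ≃ᶻ P / D → x ≃ᶻ Z.tail P / D
  ≃ᶻ-tail {P = []}    e = coeffwise λ i → coeff-≃ e (suc i)
  ≃ᶻ-tail {P = _ ∷ _} e = coeffwise λ i → coeff-≃ e (suc i)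

  ≃ᶻ-0∷ : ∀ {x P D} → x ≃ᶻ P / D → 0K ∷ x ≃ᶻ [] ∷ P / D
  ≃ᶻ-0∷ e = coeffwise λ { zero → cross ≈P-refl ; (suc i) → coeff-≃ e i }

  ≃ᶻ-+Z : ∀ {x y P Q D} → x ≃ᶻ P / D → y ≃ᶻ Q / D → x +Z y ≃ᶻ P Z.+P Q / D
  ≃ᶻ-+Z {x} {y} {P} {Q} e f = coeffwise λ i →
    ≃-cong-num (coeff-+Z x y i (coeff-≃ e i) (coeff-≃ f i)) (≈P-sym (Z.coeff-+P P Q i))
    where
    coeff-+Z : ∀ x y i {p p′ D} → coefZ x i ≃ p / D → coefZ y i ≃ p′ / D →
               coefZ (x +Z y) i ≃ p +T p′ / D
    coeff-+Z []      y       i       e f = ≃-cong-num f (+-cong (≈P-sym (0K-≃⇒≈[] e)) ≈P-refl)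
    coeff-+Z (a ∷ x) []      i {p} e f =
      ≃-cong-num e (≈P-sym (≈P-trans (+-cong ≈P-refl (0K-≃⇒≈[] f)) (T.+P-identityʳ p)))
    coeff-+Z (a ∷ x) (b ∷ y) zero    e f = ≃-+K e f
    coeff-+Z (a ∷ x) (b ∷ y) (suc i) e f = coeff-+Z x y i e f

  ≃ᶻ-scaleZ : ∀ {k c x P D D′} → k ≃ c / D → x ≃ᶻ P / D′ → scaleZ k x ≃ᶻ Z.scale c P / D *T D′
  ≃ᶻ-scaleZ {k} {c} {x} {P} {D} e f = coeffwise λ i →
    ≃-cong-num (coeff-scaleZ x i (coeff-≃ f i)) (≈P-sym (Z.coeff-scale c P i))
    where
    coeff-scaleZ : ∀ x i {p D′} → coefZ x i ≃ p / D′ → coefZ (scaleZ k x) i ≃ c *T p / D *T D′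
    coeff-scaleZ []      i       f = ≈[]⇒0K-≃ (≈P-trans (*-congˡ {c} (0K-≃⇒≈[] f)) (T.*P-zeroʳ c))
    coeff-scaleZ (a ∷ x) zero    f = ≃-*K e f
    coeff-scaleZ (a ∷ x) (suc i) f = coeff-scaleZ x i f

  ≃ᶻ-*Z : ∀ x {y P Q D D′} → x ≃ᶻ P / D → y ≃ᶻ Q / D′ → x *Z y ≃ᶻ P Z.*P Q / D *T D′
  ≃ᶻ-*Z []      {P = P} {Q} e f =
    coeffwise λ i → ≈[]⇒0K-≃ (Z.coeff-≈ (Z.*P-zeroˡ Q ([]-≃ᶻ⇒≈[] e)) i)
  ≃ᶻ-*Z (a ∷ x) {P = P} {Q} e f =
    ≃ᶻ-cong-num (≃ᶻ-+Z (≃ᶻ-scaleZ (coeff-≃ e 0) f) (≃ᶻ-0∷ (≃ᶻ-*Z x (≃ᶻ-tail e) f)))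
                (Z.*P-congˡ Q (Z.≈P-sym (Z.≈P-coeff0∷tail P)))

  ≃ᶻ-^Z : ∀ {x P D} → x ≃ᶻ P / D → ∀ m → x ^Z m ≃ᶻ P Z.^P m / D ^T m
  ≃ᶻ-^Z e zero        = coeffwise λ { zero → cross ≈P-refl ; (suc i) → cross ≈P-refl }
  ≃ᶻ-^Z {x} e (suc m) = ≃ᶻ-*Z x e (≃ᶻ-^Z e m)

  ≃ᶻ-expand : ∀ {x P D} E → x ≃ᶻ P / D → x ≃ᶻ Z.scale E P / D *T E
  ≃ᶻ-expand {P = P} E e =
    coeffwise λ i → ≃-cong-num (≃-expand E (coeff-≃ e i)) (≈P-sym (Z.coeff-scale E P i))

  ≃ᶻ-clear : ∀ {x P D} → x ≃ᶻ P / D → constZ (ιK D) *Z x ≃ᶻ P / oneT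
  ≃ᶻ-clear {x} {P} {D} e =
    ≃ᶻ-cong-num (≃ᶻ-+Z (coeffwise λ i → coeff-clear x i (coeff-≃ e i)) 0K∷[]≃[]) (Z.+P-identityʳ P)
    where
    coeff-clear : ∀ x i {p} → coefZ x i ≃ p / D → coefZ (scaleZ (ιK D) x) i ≃ p / oneT
    coeff-clear []      i       e = ≈[]⇒0K-≃ (0K-≃⇒≈[] e)
    coeff-clear (a ∷ x) zero    e = ≃-clear e
    coeff-clear (a ∷ x) (suc i) e = coeff-clear x i e
    0K∷[]≃[] : 0K ∷ [] ≃ᶻ [] / oneT
    0K∷[]≃[] = coeffwise λ { zero → cross ≈P-refl ; (suc i) → cross ≈P-refl }

  constZ-ιK≃const : ∀ p → constZ (ιK p) ≃ᶻ Z.const p / oneT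
  constZ-ιK≃const p = coeffwise λ { zero → cross ≈P-refl ; (suc i) → cross ≈P-refl }

  zZ≃X : zZ ≃ᶻ Z.X / oneT
  zZ≃X = coeffwise λ { zero → cross ≈P-refl ; (suc zero) → cross ≈P-refl ; (suc (suc i)) → cross ≈P-refl }

  coefZ-ιZ : ∀ P i → coefZ (ιZ P) i ≡ ιK (Z.coeff P i)
  coefZ-ιZ []      i       = ≡.refl
  coefZ-ιZ (c ∷ P) zero    = ≡.refl
  coefZ-ιZ (c ∷ P) (suc i) = coefZ-ιZ P i

  coefTZ≡coeff : ∀ G i → coefTZ G i ≡ Z.coeff G i
  coefTZ≡coeff []      i       = ≡.refl
  coefTZ≡coeff (c ∷ G) zero    = ≡.refl
  coefTZ≡coeff (c ∷ G) (suc i) = coefTZ≡coeff G i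

  Height≤⇒HeightLE : ∀ {G B} → Height≤ G B → HeightLE G B
  Height≤⇒HeightLE {G} h i k B<k rewrite coefTZ≡coeff G i =
    T.vanishes-above (coeff-degree≤ h i) k B<k

  ≃ᶻ-oneT⇒≈Z : ∀ {x P} → x ≃ᶻ P / oneT → x ≈Z ιZ P
  ≃ᶻ-oneT⇒≈Z {x} {P} e i rewrite coefZ-ιZ P i = T.coeff-≈ (cross-≈ (coeff-≃ e i))

module Iteration {q : ℕ} (F : FiniteField q) (2≤q : 2 ℕ.≤ q) (r′ : ℕ) where

  open import Data.Nat using (_+_; _*_; _^_; pred)
  open Over F
  open Fractions F
  open HeightArithmetic
  open T using (_≈P_; ≈P-refl; ≈P-trans; Degree≤; degree-mono; degree-^P)
  open CommutativeSemiring T.commutativeSemiring using (*-congˡ; *-congʳ; *-identityˡ; *-identityʳ)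

  private
    instance
      q-nonZero : ℕ.NonZero q
      q-nonZero = ℕ.>-nonZero (ℕₚ.≤-trans (s≤s z≤n) 2≤q)
      q^r′-nonZero : ℕ.NonZero (q ^ r′)
      q^r′-nonZero = ℕₚ.m^n≢0 q r′

    r : ℕ
    r = suc r′

    -- u = q^r − 1 and v = q^(r−1) − 1 pad the denominators of t·x and z·x^q up to that of x^(q^r).
    u v : ℕ
    u = pred (q ^ r)
    v = pred (q ^ r′)

  1≤u : 1 ≤ u
  1≤u = ℕₚ.pred-mono-≤ (ℕₚ.≤-trans 2≤q (ℕₚ.m≤m*n q (q ^ r′)))

  N+Nu≡Nq^r : ∀ N → N + N * u ≡ N * q ^ r
  N+Nu≡Nq^r N = begin
    N + N * u     ≡⟨ ℕₚ.*-suc N u ⟨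
    N * suc u     ≡⟨ ≡.cong (N *_) (ℕₚ.suc-pred (q ^ r) {{ℕₚ.m^n≢0 q r}}) ⟩
    N * q ^ r     ∎
    where open ≡.≡-Reasoning

  Nq+Nqv≡Nq^r : ∀ N → N * q + N * q * v ≡ N * q ^ r
  Nq+Nqv≡Nq^r N = begin
    N * q + N * q * v ≡⟨ ℕₚ.*-suc (N * q) v ⟨
    N * q * suc v     ≡⟨ ℕₚ.*-assoc N q (suc v) ⟩
    N * (q * suc v)   ≡⟨ ≡.cong (λ m → N * (q * m)) (ℕₚ.suc-pred (q ^ r′)) ⟩
    N * q ^ r         ∎
    where open ≡.≡-Reasoning

  ΦT-numerator : Fq[t] → ℕ → Fq[t][z] → Fq[t][z]
  ΦT-numerator Y N P =
    (Z.scale (Y ^T (N * u)) (Z.const tT Z.*P P) Z.+P Z.scale (Y ^T (N * q * v)) (Z.X Z.*P (P Z.^P q)))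
      Z.+P (P Z.^P (q ^ r))

  padded-denominator : ∀ Y m n {k} → m + n ≡ k → (oneT *T (Y ^T m)) *T (Y ^T n) ≈P Y ^T k
  padded-denominator Y m n ≡.refl =
    ≈P-trans (*-congʳ (*-identityˡ (Y ^T m))) (T.≈P-sym (T.^P-homo-*P Y m n))

  ΦT-≃ᶻ : ∀ Y N {x P} → x ≃ᶻ P / Y ^T N → ΦT r x ≃ᶻ ΦT-numerator Y N P / Y ^T (N * q ^ r)
  ΦT-≃ᶻ Y N {x} {P} x≃P = ≃ᶻ-+Z (≃ᶻ-+Z linear middle) top
    where
    linear : constZ (ιK tT) *Z x ≃ᶻ Z.scale (Y ^T (N * u)) (Z.const tT Z.*P P) / Y ^T (N * q ^ r)
    linear = ≃ᶻ-cong-den (padded-denominator Y N (N * u) (N+Nu≡Nq^r N))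
               (≃ᶻ-expand (Y ^T (N * u)) (≃ᶻ-*Z (constZ (ιK tT)) (constZ-ιK≃const tT) x≃P))
    middle : zZ *Z (x ^Z q) ≃ᶻ Z.scale (Y ^T (N * q * v)) (Z.X Z.*P (P Z.^P q)) / Y ^T (N * q ^ r)
    middle = ≃ᶻ-cong-den (padded-denominator Y (N * q) (N * q * v) (Nq+Nqv≡Nq^r N))
               (≃ᶻ-expand (Y ^T (N * q * v)) (≃ᶻ-*Z zZ zZ≃X (≃ᶻ-cong-den (T.^P-assocʳ Y N q) (≃ᶻ-^Z x≃P q))))
    top : x ^Z (q ^ r) ≃ᶻ P Z.^P (q ^ r) / Y ^T (N * q ^ r)
    top = ≃ᶻ-cong-den (T.^P-assocʳ Y N (q ^ r)) (≃ᶻ-^Z x≃P (q ^ r))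

  ΦT-numerator-height : ∀ {Y d P N} → Degree≤ Y d → 1 ≤ N → Height≤ P (N * suc d) →
                        Height≤ (ΦT-numerator Y N P) (N * q ^ r * suc d)
  ΦT-numerator-height {Y} {d} {P} {N} dY 1≤N hP = height-+P (height-+P linear middle) top
    where
    linear : Height≤ (Z.scale (Y ^T (N * u)) (Z.const tT Z.*P P)) (N * q ^ r * suc d)
    linear = height-mono (linear-term-bound N u d (N+Nu≡Nq^r N) (ℕₚ.*-mono-≤ 1≤N 1≤u))
               (height-scale (degree-^P dY (N * u)) (height-*P (Z.const tT) (height-const T.degree-X) hP))
    middle : Height≤ (Z.scale (Y ^T (N * q * v)) (Z.X Z.*P (P Z.^P q))) (N * q ^ r * suc d)
    middle = height-mono (middle-term-bound N q v d (Nq+Nqv≡Nq^r N))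
               (height-scale (degree-^P dY (N * q * v))
                 (height-*P Z.X height-X (height-^P hP q)))
    top : Height≤ (P Z.^P (q ^ r)) (N * q ^ r * suc d)
    top = height-mono (top-term-bound N (q ^ r) d) (height-^P hP (q ^ r))

  numerator : Fq[t] → Fq[t] → ℕ → Fq[t][z]
  numerator a₁ a₂ zero    = Z.const a₁
  numerator a₁ a₂ (suc n) = ΦT-numerator a₂ (q ^ (r * n)) (numerator a₁ a₂ n)

  q^[rn]*q^r≡q^[r[1+n]] : ∀ n → q ^ (r * n) * q ^ r ≡ q ^ (r * suc n)
  q^[rn]*q^r≡q^[r[1+n]] n = begin
    q ^ (r * n) * q ^ r   ≡⟨ ℕₚ.*-comm (q ^ (r * n)) (q ^ r) ⟩
    q ^ r * q ^ (r * n)   ≡⟨ ℕₚ.^-distribˡ-+-* q r (r * n) ⟨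
    q ^ (r + r * n)       ≡⟨ ≡.cong (q ^_) (ℕₚ.*-suc r n) ⟨
    q ^ (r * suc n)       ∎
    where open ≡.≡-Reasoning

  fn-≃ᶻ : ∀ a₁ a₂ n → fn r a₁ a₂ n ≃ᶻ numerator a₁ a₂ n / a₂ ^T (q ^ (r * n))
  fn-≃ᶻ a₁ a₂ zero rewrite ℕₚ.*-zeroʳ r =
    coeffwise λ { zero → cross (*-congˡ {a₁} (*-identityʳ a₂)) ; (suc i) → cross ≈P-refl }
  fn-≃ᶻ a₁ a₂ (suc n) rewrite ≡.sym (q^[rn]*q^r≡q^[r[1+n]] n) =
    ΦT-≃ᶻ a₂ (q ^ (r * n)) (fn-≃ᶻ a₁ a₂ n)

  numerator-height : ∀ {a₁ a₂ d} → Degree≤ a₁ d → Degree≤ a₂ d →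
                     ∀ n → Height≤ (numerator a₁ a₂ n) (q ^ (r * n) * suc d)
  numerator-height {d = d} da₁ da₂ zero =
    height-const (degree-mono (ℕₚ.≤-trans (ℕₚ.n≤1+n d) (ℕₚ.m≤n*m (suc d) (q ^ (r * 0)) {{ℕₚ.m^n≢0 q (r * 0)}})) da₁)
  numerator-height {d = d} da₁ da₂ (suc n) =
    height-mono (ℕₚ.≤-reflexive (≡.cong (_* suc d) (q^[rn]*q^r≡q^[r[1+n]] n)))
                (ΦT-numerator-height da₂ (ℕₚ.m^n>0 q (r * n)) (numerator-height da₁ da₂ n))

primePower≥2 : ∀ {q} → IsPrimePower q → 2 ≤ q
primePower≥2 (p , k , p-prime , ≡.refl) =
  ℕₚ.≤-trans (ℕ.nonTrivial⇒n>1 p) (ℕₚ.m≤m*n p (p ℕ.^ k) {{ℕₚ.m^n≢0 p k}})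
  where
  instance
    p-nonTrivial : ℕ.NonTrivial p
    p-nonTrivial = prime⇒nonTrivial p-prime
    p-nonZero : ℕ.NonZero p
    p-nonZero = ℕ.nonTrivial⇒nonZero p

open import Data.Nat using (_⊔_; _*_; _+_; _^_)

lemma2p5 : (r : ℕ) → 2 ≤ r → (q : ℕ) → IsPrimePower q → (F : FiniteField q) →
    (a₁ a₂ : Over.Fq[t] F) →
    ¬ (Over._≈T_ F a₁ (Over.zeroT F)) → ¬ (Over._≈T_ F a₂ (Over.zeroT F)) →
    Over.Coprime F a₁ a₂ →
    (d₁ d₂ : ℕ) → Over.IsDegree F a₁ d₁ → Over.IsDegree F a₂ d₂ →
    (n : ℕ) → 0 < n →
    ∃ λ (g : Over.Fq[t][z] F) →
      Over._≈Z_ F (Over._*Z_ F (Over.constZ F (Over.ιK F (Over._^T_ F a₂ (q ^ (r * n)))))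
                               (Over.fn F r a₁ a₂ n))
                  (Over.ιZ F g)
      × Over.HeightLE F g ((2 + (d₁ ⊔ d₂)) ^ (q ^ (r * n)))
lemma2p5 r@(suc r′) _ q q-primePower F a₁ a₂ _ _ _ d₁ d₂ (_ , a₁-vanishes) (_ , a₂-vanishes) n _ =
  numerator a₁ a₂ n , ≃ᶻ-oneT⇒≈Z (≃ᶻ-clear (fn-≃ᶻ a₁ a₂ n)) , Height≤⇒HeightLE height
  where
  open Iteration F (primePower≥2 q-primePower) r′
  open Fractions F
  open HeightArithmetic using (1+n*m≤[1+m]^n)
  d : ℕ
  d = d₁ ⊔ d₂
  height : Height≤ (numerator a₁ a₂ n) ((2 + d) ^ (q ^ (r * n)))
  height = height-mono (ℕₚ.≤-trans (ℕₚ.n≤1+n _) (1+n*m≤[1+m]^n (suc d) (q ^ (r * n))))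
             (numerator-height (T.degree-mono (ℕₚ.m≤m⊔n d₁ d₂) (T.degree≤ a₁-vanishes))
                               (T.degree-mono (ℕₚ.m≤n⊔m d₁ d₂) (T.degree≤ a₂-vanishes)) n)
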